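{- Let $n,t$ be non-negative integers and let $S = \{a(1),\ldots,a(2t)\} \subset [n]$ with $a(1) < \cdots < a(t) < a(t)+1 < a(t+1) < \cdots < a(2t)$. Let $\sigma$ be a permutation of $[t]$ and $T = T^*_n(S,\sigma)$. Then $S$ can be reconstructed from (the isomorphism class of) $T$: that is, if $S'$ and $\sigma'$ also satisfy these hypotheses and $T^*_n(S',\sigma')$ is isomorphic to $T^*_n(S,\sigma)$, then $S' = S$.
   Context: For $n \in \mathbb{N}$, $0 \le t \le n/2$, $S = \{a(1)<\cdots<a(2t)\} \subset [n]$ and a permutation $\sigma$ of $[t]$, $T^*_n(S,\sigma)$ is the tournament on $\{x_1,\ldots,x_n\}$ in which $x_i \to x_j$ whenever $i<j$, except when $i = a(\ell)$ and $j = a(t+\sigma(\ell))$ for some $\ell \in [t]$, in which case $x_j \to x_i$ (a transitive tournament with $t$ independent arcs reversed). -}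

module Defs where

open import Data.Nat using (ℕ; zero; suc; _+_; _<_)
open import Data.Fin using (Fin; toℕ; _↑ˡ_; _↑ʳ_)
open import Data.Fin.Permutation using (Permutation′; _⟨$⟩ʳ_)
open import Data.Product using (Σ; _×_; _,_; ∃)
open import Data.Sum using (_⊎_)
open import Relation.Nullary using (¬_)
open import Relation.Binary.PropositionalEquality using (_≡_)
open import Function.Bundles using (_⇔_; _↔_; Inverse)

-- Vertex x_{i+1} is represented by i : Fin n.
-- The set S = {a(1) < ... < a(2t)} is given by a : Fin (t + t) → Fin n
-- (a(ℓ) for ℓ ∈ [t] is  a ((ℓ-1) ↑ˡ t),  a(t+m) is  a (t ↑ʳ (m-1))).

StrictlyIncreasing : ∀ {n m} → (Fin m → Fin n) → Set
StrictlyIncreasing {m = m} a = ∀ (i j : Fin m) → toℕ i < toℕ j → toℕ (a i) < toℕ (a j)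

-- the hypothesis  a(1) < ... < a(t) < a(t)+1 < a(t+1) < ... < a(2t)
Admissible : (n t : ℕ) → (Fin (t + t) → Fin n) → Set
Admissible n t a =
  StrictlyIncreasing a ×
  (∀ (i j : Fin t) → suc (toℕ i) ≡ t → toℕ j ≡ 0 →
     suc (toℕ (a (i ↑ˡ t))) < toℕ (a (t ↑ʳ j)))

Reversed : ∀ {n t} → (Fin (t + t) → Fin n) → Permutation′ t → Fin n → Fin n → Set
Reversed {t = t} a σ i j =
  ∃ λ (ℓ : Fin t) → (a (ℓ ↑ˡ t) ≡ i) × (a (t ↑ʳ (σ ⟨$⟩ʳ ℓ)) ≡ j)

-- arc relation of T*_n(S,σ):  Arc a σ i j  means  x_i → x_j
Arc : ∀ {n t} → (Fin (t + t) → Fin n) → Permutation′ t → Fin n → Fin n → Set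
Arc a σ i j =
  (toℕ i < toℕ j × ¬ Reversed a σ i j) ⊎ (toℕ j < toℕ i × Reversed a σ j i)

Isomorphic : ∀ {n} → (Fin n → Fin n → Set) → (Fin n → Fin n → Set) → Set
Isomorphic {n} R R′ =
  Σ (Fin n ↔ Fin n) λ f → ∀ i j → R i j ⇔ R′ (Inverse.to f i) (Inverse.to f j)

InSet : ∀ {n m} → (Fin m → Fin n) → Fin n → Set
InSet a x = ∃ λ ℓ → a ℓ ≡ x

-- Let l(v), r(v) ∈ {0,1} record whether vertex v lies in {a(1),…,a(t)} or in {a(t+1),…,a(2t)}.
-- Every reversed arc runs from a lower to an upper vertex, so the out-degree of v is
-- (n − 1 − v) − l(v) + r(v), and the gap a(t)+1 < a(t+1) makes it non-increasing in v.  A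
-- non-increasing sequence is determined by its multiset of values, an isomorphism invariant,
-- so T*_n(S,σ) and T*_n(S′,σ′) have the same out-degree at every vertex.  Hence
-- l(v) + r′(v) = l′(v) + r(v), and as l′(v), r′(v) are never both 1, v ∈ S′ forces v ∈ S.
module Submission where

open import Defs
open import Level using (Level; 0ℓ)
open import Data.Nat using (ℕ; zero; suc; _+_; _≤_; _<_; z≤n; s≤s; s<s⁻¹; _<?_; _≤?_)
open import Data.Nat.Properties
  using ( ≤-refl; ≤-reflexive; ≤-trans; ≤-antisym; <⇒≤; <⇒≱; <-irrefl; <-asym; <-trans; <-cmp
        ; n≤1+n; n<1+n; m≤n⇒m<n∨m≡n; m≤m+n; +-suc; +-comm; +-identityʳ
        ; +-cancelˡ-≡; +-cancelʳ-≤; +-mono-≤; +-monoˡ-≤; +-monoʳ-≤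
        ; +-0-commutativeMonoid; +-commutativeSemigroup; module ≤-Reasoning)
open import Data.Nat.Tactic.RingSolver using (solve-∀)
open import Data.Fin using (Fin; zero; suc; toℕ; _↑ˡ_; _↑ʳ_; fromℕ; splitAt; _≟_)
open import Data.Fin.Properties
  using ( any?; toℕ-↑ˡ; toℕ-↑ʳ; toℕ-injective; toℕ-fromℕ; ≤fromℕ; 0≢1+n; suc-injective
        ; ↑ˡ-injective; ↑ʳ-injective; splitAt⁻¹-↑ˡ; splitAt⁻¹-↑ʳ)
open import Data.Fin.Permutation using (Permutation′; _⟨$⟩ʳ_; _⟨$⟩ˡ_; inverseʳ)
open import Data.Product using (_×_; _,_; ∃; proj₁; proj₂)
open import Data.Sum using (_⊎_; inj₁; inj₂)
open import Function.Base using (_∘_)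
open import Function.Bundles using (_⇔_; _↔_; mk⇔; Equivalence; Inverse; Injection)
open import Function.Properties.Inverse using (↔⇒↣)
open import Relation.Nullary using (¬_; Dec; yes; no; contradiction)
open import Relation.Nullary.Decidable using (_×-dec_; _⊎-dec_; ¬?; decidable-stable)
open import Relation.Unary using (Pred; Decidable)
open import Relation.Binary.Definitions using (tri<; tri≈; tri>)
open import Relation.Binary.PropositionalEquality
open import Algebra.Properties.CommutativeSemigroup +-commutativeSemigroup using (xy∙z≈xz∙y)
open import Algebra.Properties.CommutativeMonoid.Sum +-0-commutativeMonoid
  using (sum; sum-cong-≗; sum-replicate-zero; ∑-distrib-+; sum-permute)

open Equivalence using (to; from)

private
  variable
    p q : Level
    P Q : Set p
    n : ℕ

𝟙 : Dec P → ℕ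
𝟙 (yes _) = 1
𝟙 (no _)  = 0

𝟙-yes : (P? : Dec P) → P → 𝟙 P? ≡ 1
𝟙-yes (yes _) _  = refl
𝟙-yes (no ¬p) p = contradiction p ¬p

𝟙-no : (P? : Dec P) → ¬ P → 𝟙 P? ≡ 0
𝟙-no (yes p) ¬p = contradiction p ¬p
𝟙-no (no _)  _  = refl

𝟙-⇔ : (P? : Dec P) (Q? : Dec Q) → P ⇔ Q → 𝟙 P? ≡ 𝟙 Q?
𝟙-⇔ (yes p) Q? P⇔Q = sym (𝟙-yes Q? (to P⇔Q p))
𝟙-⇔ (no ¬p) Q? P⇔Q = sym (𝟙-no Q? (¬p ∘ from P⇔Q))

𝟙-complement : (P? : Dec P) (Q? : Dec Q) → P ⇔ (¬ Q) → 𝟙 P? + 𝟙 Q? ≡ 1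
𝟙-complement (yes p) Q? P⇔¬Q = cong suc (𝟙-no Q? (to P⇔¬Q p))
𝟙-complement (no ¬p) Q? P⇔¬Q = 𝟙-yes Q? (decidable-stable Q? (¬p ∘ from P⇔¬Q))

𝟙≤1 : (P? : Dec P) → 𝟙 P? ≤ 1
𝟙≤1 (yes _) = s≤s z≤n
𝟙≤1 (no _)  = z≤n

count : {P : Pred (Fin n) p} → Decidable P → ℕ
count P? = sum (λ v → 𝟙 (P? v))

module _ {P : Pred (Fin n) p} (P? : Decidable P) where

  count-none : (∀ v → ¬ P v) → count P? ≡ 0
  count-none ¬P = trans (sum-cong-≗ (λ v → 𝟙-no (P? v) (¬P v))) (sum-replicate-zero n)

  count-cong : {Q : Pred (Fin n) q} (Q? : Decidable Q) → (∀ v → P v ⇔ Q v) → count P? ≡ count Q?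
  count-cong Q? P⇔Q = sum-cong-≗ (λ v → 𝟙-⇔ (P? v) (Q? v) (P⇔Q v))

count-all : {P : Pred (Fin n) p} (P? : Decidable P) → (∀ v → P v) → count P? ≡ n
count-all {n = zero}  P? all = refl
count-all {n = suc n} P? all = cong₂ _+_ (𝟙-yes (P? zero) (all zero)) (count-all (P? ∘ suc) (all ∘ suc))

count-single : {P : Pred (Fin n) p} (P? : Decidable P) (c : Fin n) →
               P c → (∀ {v} → P v → v ≡ c) → count P? ≡ 1
count-single P? zero    Pc only =
  cong₂ _+_ (𝟙-yes (P? zero) Pc) (count-none (P? ∘ suc) (λ v → 0≢1+n ∘ sym ∘ only))
count-single P? (suc c) Pc only =
  cong₂ _+_ (𝟙-no (P? zero) (0≢1+n ∘ only)) (count-single (P? ∘ suc) c Pc (suc-injective ∘ only))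

count-atMostOne : {P : Pred (Fin n) p} (P? : Decidable P) →
                  (∀ {v w} → P v → P w → v ≡ w) → count P? ≡ 𝟙 (any? P?)
count-atMostOne P? unique with any? P?
... | yes (c , Pc) = count-single P? c Pc (λ Pv → unique Pv Pc)
... | no ¬∃P       = count-none P? (λ v Pv → ¬∃P (v , Pv))

after? : (v : Fin n) → Decidable (λ (w : Fin n) → toℕ v < toℕ w)
after? v w = toℕ v <? toℕ w

count-after : (v : Fin n) → count (after? v) + suc (toℕ v) ≡ n
count-after {suc n} zero =
  trans (cong (_+ 1) (count-all (λ w → after? zero (suc w)) (λ _ → s≤s z≤n))) (+-comm n 1)
count-after {suc n} (suc v) = begin
  count (after? (suc v)) + suc (suc (toℕ v))         ≡⟨ +-suc _ (suc (toℕ v)) ⟩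
  suc (count (after? (suc v)) + suc (toℕ v))         ≡⟨ cong (λ k → suc (k + suc (toℕ v))) shift ⟩
  suc (count (after? v) + suc (toℕ v))               ≡⟨ cong suc (count-after v) ⟩
  suc n                                                        ∎
  where
  open ≡-Reasoning
  shift : count (λ w → after? (suc v) (suc w)) ≡ count (after? v)
  shift = count-cong (λ w → after? (suc v) (suc w)) (after? v) (λ w → mk⇔ s<s⁻¹ s≤s)

count-prefix : {P : Pred (Fin n) p} (P? : Decidable P) (x : Fin n) →
               (∀ v → toℕ v ≤ toℕ x → P v) → toℕ x < count P?
count-prefix P? zero    P≤x rewrite 𝟙-yes (P? zero) (P≤x zero z≤n) = s≤s z≤n
count-prefix P? (suc x) P≤x rewrite 𝟙-yes (P? zero) (P≤x zero z≤n) =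
  s≤s (count-prefix (P? ∘ suc) x (λ v → P≤x (suc v) ∘ s≤s))

count-beyond : {P : Pred (Fin n) p} (P? : Decidable P) (x : Fin n) →
               (∀ v → toℕ x ≤ toℕ v → ¬ P v) → count P? ≤ toℕ x
count-beyond P? zero    ¬P≥x = ≤-reflexive (count-none P? (λ v → ¬P≥x v z≤n))
count-beyond P? (suc x) ¬P≥x =
  +-mono-≤ (𝟙≤1 (P? zero)) (count-beyond (P? ∘ suc) x (λ v → ¬P≥x (suc v) ∘ s≤s))

NonIncreasing : (Fin n → ℕ) → Set
NonIncreasing g = ∀ u v → toℕ u ≤ toℕ v → g v ≤ g u

atLeast : (Fin n → ℕ) → ℕ → ℕ
atLeast g c = count (λ v → c ≤? g v)

threshold : (g : Fin n → ℕ) → NonIncreasing g → ∀ c x → c ≤ g x ⇔ toℕ x < atLeast g c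
threshold g g↓ c x = mk⇔
  (λ c≤gx → count-prefix (λ v → c ≤? g v) x (λ v v≤x → ≤-trans c≤gx (g↓ v x v≤x)))
  (λ x<cnt → decidable-stable (c ≤? g x) λ c≰gx → <⇒≱ x<cnt
    (count-beyond (λ v → c ≤? g v) x (λ v x≤v c≤gv → c≰gx (≤-trans c≤gv (g↓ x v x≤v)))))

atLeast-≤ : (g h : Fin n → ℕ) → NonIncreasing g → NonIncreasing h →
            (∀ c → atLeast g c ≡ atLeast h c) → ∀ x → g x ≤ h x
atLeast-≤ g h g↓ h↓ same x =
  from (threshold h h↓ (g x) x) (subst (toℕ x <_) (same (g x)) (to (threshold g g↓ (g x) x) ≤-refl))

nonIncreasing-unique : (g h : Fin n → ℕ) → NonIncreasing g → NonIncreasing h →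
                       (∀ c → atLeast g c ≡ atLeast h c) → ∀ x → g x ≡ h x
nonIncreasing-unique g h g↓ h↓ same x =
  ≤-antisym (atLeast-≤ g h g↓ h↓ same x) (atLeast-≤ h g h↓ g↓ (sym ∘ same) x)

outdegree : {R : Fin n → Fin n → Set} → (∀ i j → Dec (R i j)) → Fin n → ℕ
outdegree R? v = count (R? v)

module _ {R R′ : Fin n → Fin n → Set} (R? : ∀ i j → Dec (R i j)) (R′? : ∀ i j → Dec (R′ i j))
         (iso : Isomorphic R R′) where

  private
    f : Fin n ↔ Fin n
    f = proj₁ iso

  isomorphic⇒outdegree : ∀ v → outdegree R? v ≡ outdegree R′? (Inverse.to f v)
  isomorphic⇒outdegree v =
    trans (count-cong (R? v) (λ w → R′? (Inverse.to f v) (Inverse.to f w)) (proj₂ iso v))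
          (sym (sum-permute (λ w → 𝟙 (R′? (Inverse.to f v) w)) f))

  isomorphic-nonIncreasing⇒outdegree-≗ : NonIncreasing (outdegree R?) → NonIncreasing (outdegree R′?) →
                                         ∀ x → outdegree R? x ≡ outdegree R′? x
  isomorphic-nonIncreasing⇒outdegree-≗ R↓ R′↓ = nonIncreasing-unique _ _ R↓ R′↓ λ c →
    trans (sum-cong-≗ (λ v → cong (λ d → 𝟙 (c ≤? d)) (isomorphic⇒outdegree v)))
          (sym (sum-permute (λ v → 𝟙 (c ≤? outdegree R′? v)) f))

strictlyIncreasing⇒injective : {m : ℕ} {a : Fin m → Fin n} → StrictlyIncreasing a →
                               ∀ {i j} → a i ≡ a j → i ≡ j
strictlyIncreasing⇒injective inc {i} {j} ai≡aj with <-cmp (toℕ i) (toℕ j)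
... | tri< i<j _ _ = contradiction (inc i j i<j) (<-irrefl (cong toℕ ai≡aj))
... | tri≈ _ i≡j _ = toℕ-injective i≡j
... | tri> _ _ j<i = contradiction (inc j i j<i) (<-irrefl (cong toℕ (sym ai≡aj)))

strictlyIncreasing⇒monotone : {m : ℕ} {a : Fin m → Fin n} → StrictlyIncreasing a →
                              ∀ i j → toℕ i ≤ toℕ j → toℕ (a i) ≤ toℕ (a j)
strictlyIncreasing⇒monotone {a = a} inc i j i≤j with m≤n⇒m<n∨m≡n i≤j
... | inj₁ i<j = <⇒≤ (inc i j i<j)
... | inj₂ i≡j = ≤-reflexive (cong (toℕ ∘ a) (toℕ-injective i≡j))

admissible-gap : {t : ℕ} {a : Fin (t + t) → Fin n} → Admissible n t a →
                 ∀ ℓ m → suc (toℕ (a (ℓ ↑ˡ t))) < toℕ (a (t ↑ʳ m))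
admissible-gap {t = suc k} {a} (inc , gap) ℓ m = begin-strict
  suc (toℕ (a (ℓ ↑ˡ suc k)))        ≤⟨ s≤s (mono (ℓ ↑ˡ suc k) (fromℕ k ↑ˡ suc k) ℓ≤last) ⟩
  suc (toℕ (a (fromℕ k ↑ˡ suc k)))  <⟨ gap (fromℕ k) zero (cong suc (toℕ-fromℕ k)) refl ⟩
  toℕ (a (suc k ↑ʳ zero))           ≤⟨ mono (suc k ↑ʳ zero) (suc k ↑ʳ m) first≤m ⟩
  toℕ (a (suc k ↑ʳ m))              ∎
  where
  open ≤-Reasoning
  mono : ∀ i j → toℕ i ≤ toℕ j → toℕ (a i) ≤ toℕ (a j)
  mono = strictlyIncreasing⇒monotone inc
  ℓ≤last : toℕ (ℓ ↑ˡ suc k) ≤ toℕ (fromℕ k ↑ˡ suc k)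
  ℓ≤last = subst₂ _≤_ (sym (toℕ-↑ˡ ℓ (suc k))) (sym (toℕ-↑ˡ (fromℕ k) (suc k))) (≤fromℕ ℓ)
  first≤m : toℕ (suc k ↑ʳ zero) ≤ toℕ (suc k ↑ʳ m)
  first≤m = subst₂ _≤_ (sym (toℕ-↑ʳ (suc k) zero)) (sym (toℕ-↑ʳ (suc k) m)) (+-monoʳ-≤ (suc k) z≤n)

balance-cancel : ∀ d s m {l r l′ r′} → d + l + s ≡ m + r → d + l′ + s ≡ m + r′ → l′ + r ≡ l + r′
balance-cancel d s m {l} {r} {l′} {r′} eq eq′ = +-cancelˡ-≡ (d + s) _ _ (begin
  d + s + (l′ + r)  ≡⟨ regroup d s l′ r ⟩
  d + l′ + s + r    ≡⟨ cong (_+ r) eq′ ⟩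
  m + r′ + r        ≡⟨ xy∙z≈xz∙y m r′ r ⟩
  m + r + r′        ≡⟨ cong (_+ r′) eq ⟨
  d + l + s + r′    ≡⟨ regroup d s l r′ ⟨
  d + s + (l + r′)  ∎)
  where
  open ≡-Reasoning
  regroup : ∀ d s l r → d + s + (l + r) ≡ d + l + s + r
  regroup = solve-∀

balanced-⊎ : {L R L′ R′ : Set} (L? : Dec L) (R? : Dec R) (L′? : Dec L′) (R′? : Dec R′) →
             ¬ (L′ × R′) → 𝟙 L′? + 𝟙 R? ≡ 𝟙 L? + 𝟙 R′? → L′ ⊎ R′ → L ⊎ R
balanced-⊎ (yes l) _       _        _        _        _  _        = inj₁ l
balanced-⊎ (no _)  (yes r) _        _        _        _  _        = inj₂ r
balanced-⊎ (no _)  (no _)  (yes l′) (yes r′) disjoint _  _        = contradiction (l′ , r′) disjoint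
balanced-⊎ (no _)  (no _)  (yes _)  (no _)   _        () _
balanced-⊎ (no _)  (no _)  (no _)   (yes _)  _        () _
balanced-⊎ (no _)  (no _)  (no ¬l′) (no _)   _        _  (inj₁ l′) = contradiction l′ ¬l′
balanced-⊎ (no _)  (no _)  (no _)   (no ¬r′) _        _  (inj₂ r′) = contradiction r′ ¬r′

module Tournament {t : ℕ} (a : Fin (t + t) → Fin n) (σ : Permutation′ t) (adm : Admissible n t a) where

  Lower Upper : Pred (Fin n) 0ℓ
  Lower v = ∃ λ ℓ → a (ℓ ↑ˡ t) ≡ v
  Upper v = ∃ λ m → a (t ↑ʳ m) ≡ v

  lower? : Decidable Lower
  lower? v = any? (λ ℓ → a (ℓ ↑ˡ t) ≟ v)

  upper? : Decidable Upper
  upper? v = any? (λ m → a (t ↑ʳ m) ≟ v)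

  gap : ∀ {u v} → Lower u → Upper v → suc (toℕ u) < toℕ v
  gap (ℓ , refl) (m , refl) = admissible-gap adm ℓ m

  lower-upper-disjoint : ∀ {v} → ¬ (Lower v × Upper v)
  lower-upper-disjoint (l , u) = <⇒≱ (gap l u) (n≤1+n _)

  inSet⇔lower⊎upper : ∀ {v} → InSet a v ⇔ (Lower v ⊎ Upper v)
  inSet⇔lower⊎upper = mk⇔ split join
    where
    split : ∀ {v} → InSet a v → Lower v ⊎ Upper v
    split (k , refl) with splitAt t k in eq
    ... | inj₁ ℓ = inj₁ (ℓ , cong a (splitAt⁻¹-↑ˡ eq))
    ... | inj₂ m = inj₂ (m , cong a (splitAt⁻¹-↑ʳ eq))
    join : ∀ {v} → Lower v ⊎ Upper v → InSet a v
    join (inj₁ (ℓ , e)) = ℓ ↑ˡ t , e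
    join (inj₂ (m , e)) = t ↑ʳ m , e

  Rev : Fin n → Fin n → Set
  Rev = Reversed a σ

  rev? : ∀ i j → Dec (Rev i j)
  rev? i j = any? (λ ℓ → (a (ℓ ↑ˡ t) ≟ i) ×-dec (a (t ↑ʳ (σ ⟨$⟩ʳ ℓ)) ≟ j))

  arc? : ∀ i j → Dec (Arc a σ i j)
  arc? i j = ((toℕ i <? toℕ j) ×-dec ¬? (rev? i j)) ⊎-dec ((toℕ j <? toℕ i) ×-dec rev? j i)

  rev-< : ∀ {i j} → Rev i j → toℕ i < toℕ j
  rev-< (ℓ , i≡ , j≡) = <-trans (n<1+n _) (gap (ℓ , i≡) (σ ⟨$⟩ʳ ℓ , j≡))

  a-injective : ∀ {i j} → a i ≡ a j → i ≡ j
  a-injective = strictlyIncreasing⇒injective (proj₁ adm)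

  revFrom-unique : ∀ {v w w′} → Rev v w → Rev v w′ → w ≡ w′
  revFrom-unique (ℓ , refl , refl) (ℓ′ , e , refl)
    with ↑ˡ-injective t ℓ ℓ′ (a-injective (sym e))
  ... | refl = refl

  revTo-unique : ∀ {v w w′} → Rev w v → Rev w′ v → w ≡ w′
  revTo-unique (ℓ , refl , refl) (ℓ′ , refl , e)
    with Injection.injective (↔⇒↣ σ) (↑ʳ-injective t _ _ (a-injective (sym e)))
  ... | refl = refl

  count-revFrom : ∀ v → count (rev? v) ≡ 𝟙 (lower? v)
  count-revFrom v = trans (count-atMostOne (rev? v) revFrom-unique) (𝟙-⇔ _ (lower? v) (mk⇔
    (λ (_ , ℓ , e , _) → ℓ , e)
    (λ (ℓ , e) → a (t ↑ʳ (σ ⟨$⟩ʳ ℓ)) , ℓ , e , refl)))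

  count-revTo : ∀ v → count (λ w → rev? w v) ≡ 𝟙 (upper? v)
  count-revTo v = trans (count-atMostOne (λ w → rev? w v) revTo-unique) (𝟙-⇔ _ (upper? v) (mk⇔
    (λ (_ , ℓ , _ , e) → σ ⟨$⟩ʳ ℓ , e)
    (λ (m , e) → a (σ ⟨$⟩ˡ m ↑ˡ t) , σ ⟨$⟩ˡ m , refl , trans (cong (a ∘ (t ↑ʳ_)) (inverseʳ σ)) e)))

  -- [v → w] = [v < w] − [Rev v w] + [Rev w v], moved so that no subtraction occurs.
  arc+rev : ∀ v w → 𝟙 (arc? v w) + 𝟙 (rev? v w) ≡ 𝟙 (after? v w) + 𝟙 (rev? w v)
  arc+rev v w with <-cmp (toℕ v) (toℕ w)
  ... | tri< v<w _ _ = begin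
    𝟙 (arc? v w) + 𝟙 (rev? v w)
      ≡⟨ 𝟙-complement (arc? v w) (rev? v w) (mk⇔ forward (λ ¬r → inj₁ (v<w , ¬r))) ⟩
    1
      ≡⟨ cong₂ _+_ (𝟙-yes (after? v w) v<w) (𝟙-no (rev? w v) (<-asym v<w ∘ rev-<)) ⟨
    𝟙 (after? v w) + 𝟙 (rev? w v) ∎
    where
    open ≡-Reasoning
    forward : Arc a σ v w → ¬ Rev v w
    forward (inj₁ (_ , ¬r)) = ¬r
    forward (inj₂ (w<v , _)) = contradiction w<v (<-asym v<w)
  ... | tri≈ _ v≡w _ = begin
    𝟙 (arc? v w) + 𝟙 (rev? v w)
      ≡⟨ cong₂ _+_ (𝟙-no (arc? v w) no-arc) (𝟙-no (rev? v w) (<-irrefl v≡w ∘ rev-<)) ⟩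
    0
      ≡⟨ cong₂ _+_ (𝟙-no (after? v w) (<-irrefl v≡w)) (𝟙-no (rev? w v) (<-irrefl (sym v≡w) ∘ rev-<)) ⟨
    𝟙 (after? v w) + 𝟙 (rev? w v) ∎
    where
    open ≡-Reasoning
    no-arc : ¬ Arc a σ v w
    no-arc (inj₁ (v<w , _)) = <-irrefl v≡w v<w
    no-arc (inj₂ (w<v , _)) = <-irrefl (sym v≡w) w<v
  ... | tri> _ _ w<v = begin
    𝟙 (arc? v w) + 𝟙 (rev? v w)
      ≡⟨ cong₂ _+_ (𝟙-⇔ (arc? v w) (rev? w v) arc⇔rev) (𝟙-no (rev? v w) (<-asym w<v ∘ rev-<)) ⟩
    𝟙 (rev? w v) + 0
      ≡⟨ +-identityʳ _ ⟩
    𝟙 (rev? w v)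
      ≡⟨ cong (_+ 𝟙 (rev? w v)) (𝟙-no (after? v w) (<-asym w<v)) ⟨
    𝟙 (after? v w) + 𝟙 (rev? w v) ∎
    where
    open ≡-Reasoning
    arc⇔rev : Arc a σ v w ⇔ Rev w v
    arc⇔rev = mk⇔ (λ { (inj₁ (v<w , _)) → contradiction v<w (<-asym w<v) ; (inj₂ (_ , r)) → r })
                  (λ r → inj₂ (w<v , r))

  outdegree-formula : ∀ v → outdegree arc? v + 𝟙 (lower? v) + suc (toℕ v) ≡ n + 𝟙 (upper? v)
  outdegree-formula v = begin
    count (arc? v) + 𝟙 (lower? v) + suc (toℕ v)
      ≡⟨ cong (λ k → count (arc? v) + k + suc (toℕ v)) (count-revFrom v) ⟨
    count (arc? v) + count (rev? v) + suc (toℕ v)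
      ≡⟨ cong (_+ suc (toℕ v)) (∑-distrib-+ (λ w → 𝟙 (arc? v w)) (λ w → 𝟙 (rev? v w))) ⟨
    sum (λ w → 𝟙 (arc? v w) + 𝟙 (rev? v w)) + suc (toℕ v)
      ≡⟨ cong (_+ suc (toℕ v)) (sum-cong-≗ (arc+rev v)) ⟩
    sum (λ w → 𝟙 (after? v w) + 𝟙 (rev? w v)) + suc (toℕ v)
      ≡⟨ cong (_+ suc (toℕ v)) (∑-distrib-+ (λ w → 𝟙 (after? v w)) (λ w → 𝟙 (rev? w v))) ⟩
    count (after? v) + count (λ w → rev? w v) + suc (toℕ v)
      ≡⟨ xy∙z≈xz∙y (count (after? v)) _ _ ⟩
    count (after? v) + suc (toℕ v) + count (λ w → rev? w v)
      ≡⟨ cong₂ _+_ (count-after v) (count-revTo v) ⟩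
    n + 𝟙 (upper? v) ∎
    where open ≡-Reasoning

  lower+upper+index≤ : ∀ {u v} → toℕ u < toℕ v → 𝟙 (lower? u) + 𝟙 (upper? v) + toℕ u ≤ toℕ v
  lower+upper+index≤ {u} {v} u<v with lower? u | upper? v
  ... | yes l | yes r = gap l r
  ... | yes _ | no _  = u<v
  ... | no _  | yes _ = u<v
  ... | no _  | no _  = <⇒≤ u<v

  outdegree-nonIncreasing : NonIncreasing (outdegree arc?)
  outdegree-nonIncreasing u v u≤v with m≤n⇒m<n∨m≡n u≤v
  ... | inj₂ u≡v = ≤-reflexive (cong (outdegree arc?) (sym (toℕ-injective u≡v)))
  ... | inj₁ u<v = +-cancelʳ-≤ (suc (toℕ v)) (deg v) (deg u) (begin
    deg v + suc (toℕ v)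
      ≤⟨ +-monoˡ-≤ _ (m≤m+n (deg v) (𝟙 (lower? v))) ⟩
    deg v + 𝟙 (lower? v) + suc (toℕ v)
      ≡⟨ outdegree-formula v ⟩
    n + 𝟙 (upper? v)
      ≤⟨ +-monoˡ-≤ _ (m≤m+n n (𝟙 (upper? u))) ⟩
    n + 𝟙 (upper? u) + 𝟙 (upper? v)
      ≡⟨ cong (_+ 𝟙 (upper? v)) (outdegree-formula u) ⟨
    deg u + 𝟙 (lower? u) + suc (toℕ u) + 𝟙 (upper? v)
      ≡⟨ regroup (deg u) (𝟙 (lower? u)) (toℕ u) (𝟙 (upper? v)) ⟩
    deg u + suc (𝟙 (lower? u) + 𝟙 (upper? v) + toℕ u)
      ≤⟨ +-monoʳ-≤ (deg u) (s≤s (lower+upper+index≤ u<v)) ⟩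
    deg u + suc (toℕ v) ∎)
    where
    open ≤-Reasoning
    deg : Fin n → ℕ
    deg = outdegree arc?
    regroup : ∀ d l x r → d + l + suc x + r ≡ d + suc (l + r + x)
    regroup = solve-∀

module _ {n t t′ : ℕ} {a : Fin (t + t) → Fin n} {a′ : Fin (t′ + t′) → Fin n}
         (σ : Permutation′ t) (σ′ : Permutation′ t′)
         (adm : Admissible n t a) (adm′ : Admissible n t′ a′) where

  private
    module T  = Tournament a σ adm
    module T′ = Tournament a′ σ′ adm′

  inSet-transfer : ∀ x → outdegree T′.arc? x ≡ outdegree T.arc? x → InSet a′ x → InSet a x
  inSet-transfer x same =
    from T.inSet⇔lower⊎upper ∘
    balanced-⊎ (T.lower? x) (T.upper? x) (T′.lower? x) (T′.upper? x) T′.lower-upper-disjoint balance ∘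
    to T′.inSet⇔lower⊎upper
    where
    balance : 𝟙 (T′.lower? x) + 𝟙 (T.upper? x) ≡ 𝟙 (T.lower? x) + 𝟙 (T′.upper? x)
    balance = balance-cancel (outdegree T.arc? x) (suc (toℕ x)) n (T.outdegree-formula x)
      (subst (λ d → d + 𝟙 (T′.lower? x) + suc (toℕ x) ≡ n + 𝟙 (T′.upper? x)) same (T′.outdegree-formula x))

mainTheorem11 : (n t t′ : ℕ)
    → (a : Fin (t + t) → Fin n) → (σ : Permutation′ t)
    → (a′ : Fin (t′ + t′) → Fin n) → (σ′ : Permutation′ t′)
    → Admissible n t a → Admissible n t′ a′
    → Isomorphic (Arc a′ σ′) (Arc a σ)
    → ∀ (x : Fin n) → InSet a′ x ⇔ InSet a x
mainTheorem11 n t t′ a σ a′ σ′ adm adm′ iso x =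
  mk⇔ (inSet-transfer σ σ′ adm adm′ x same) (inSet-transfer σ′ σ adm′ adm x (sym same))
  where
  module T  = Tournament a σ adm
  module T′ = Tournament a′ σ′ adm′
  same : outdegree T′.arc? x ≡ outdegree T.arc? x
  same = isomorphic-nonIncreasing⇒outdegree-≗ T′.arc? T.arc? iso
           T′.outdegree-nonIncreasing T.outdegree-nonIncreasing x
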